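{- (Strong necessitation.) Let $T$ be a set of formulas with $T\vdash\gamma$. Then (1) $\bigcirc T\vdash\bigcirc\gamma$, (2) $\ominus T\vdash\ominus\gamma$, and (3) $K_aT\vdash K_a\gamma$ for every agent $a$, where $\bigcirc T=\{\bigcirc\alpha:\alpha\in T\}$, $\ominus T=\{\ominus\alpha:\alpha\in T\}$, $K_aT=\{K_a\alpha:\alpha\in T\}$.
   Context: Setting (PTEL). Formulas are built from propositional letters (including $A_a$, "agent $a$ is active", for each agent $a$ of a finite set $\mathcal A$) with $\neg,\wedge$, unary $\bigcirc$ (next), $\ominus$ (previous), $K_a$, $C$ (common knowledge), $P_{\geqslant s}$, $P_{a,\geqslant s}$ ($s$ rational in $[0,1]$) and binary $\mathsf U$ (until), $\mathsf S$ (since); $E\alpha=\bigwedge_aK_a\alpha$, $E^0\alpha=\alpha$, $E^{n+1}\alpha=EE^n\alpha$, $F\alpha=(\alpha\to\alpha)\mathsf U\alpha$, $P_{<s}\alpha=\neg P_{\geqslant s}\alpha$, $P_{\leqslant s}\alpha=P_{\geqslant1-s}\neg\alpha$ (analogously for $P_{a,\cdot}$). $k$-nested implications: for $\mathcal B=(\beta_0,\dots,\beta_k)$, $\mathcal X=(X_1,\dots,X_k)$ with $X_j\in\{K_a\}\cup\{\bigcirc,\ominus\}$: $N_0(\mathcal B,\mathcal X,\alpha)=\beta_0\to\alpha$, $N_k(\mathcal B,\mathcal X,\alpha)=\beta_k\to X_kN_{k-1}((\beta_0,\dots,\beta_{k-1}),(X_1,\dots,X_{k-1}),\alpha)$. Axiom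 system $\mathrm{Ax}$: propositional tautologies, modus ponens; temporal axioms $\neg\bigcirc\alpha\leftrightarrow\bigcirc\neg\alpha$, $\bigcirc(\alpha\to\beta)\to(\bigcirc\alpha\to\bigcirc\beta)$, $\alpha\mathsf U\beta\leftrightarrow\beta\vee(\alpha\wedge\bigcirc(\alpha\mathsf U\beta))$, $\alpha\mathsf U\beta\to F\beta$, $\neg\ominus\neg\alpha\to\ominus\alpha$, $\ominus(\alpha\to\beta)\to(\ominus\alpha\to\ominus\beta)$, $(\ominus\alpha\wedge\ominus\beta)\to\ominus(\alpha\wedge\beta)$, $\bigcirc\ominus\alpha\leftrightarrow\alpha$, $\bigcirc\ominus\alpha\to\ominus\bigcirc\alpha$, $\neg\ominus(\gamma\wedge\neg\gamma)\to(\bigcirc\ominus\alpha\leftrightarrow\ominus\bigcirc\alpha)$, $\alpha\mathsf S\beta\leftrightarrow[\beta\vee(\neg\ominus(\alpha\wedge\neg\alpha)\wedge[\alpha\wedge\ominus(\alpha\mathsf S\beta)])]$, $(\ominus\beta\to\ominus\beta)\,\mathsf S\,\ominus\beta$; necessitation for $\bigcirc,\ominus$; infinitary rules R$\mathsf U$ (from $N_k(\mathcal B,\mathcal X,\neg((\bigwedge_{l=0}^{i-1}\bigcirc^l\alpha)\wedge\bigcirc^i\beta))$ for all $i\in\mathbb N$ infer $N_k(\mathcal B,\mathcal X,\neg(\alpha\mathsf U\beta))$) and R$\mathsf S$ (from $N_k(\mathcal B,\mathcal X,\neg((\bigwedge_{l=0}^{i-1}\ominus^l\alpha)\wedge(\bigwedge_{l=0}^{i}\neg\ominus^l(\alpha\wedge\neg\alpha))\wedge\ominus^i\beta))$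 for all $i$ infer $N_k(\mathcal B,\mathcal X,\neg(\alpha\mathsf S\beta))$); epistemic axioms $K_a(\alpha\to\beta)\to(K_a\alpha\to K_a\beta)$, $A_a\to(K_a\alpha\to\alpha)$, $A_a\to K_aA_a$, $\neg A_a\to K_a(\alpha\wedge\neg\alpha)$, $K_a\neg\alpha\to K_a\neg K_a\alpha$, $K_a\alpha\to K_aK_a\alpha$, $C\alpha\to E^m\alpha$, necessitation for $K_a$, rule RC (from $N_k(\mathcal B,\mathcal X,E^i\alpha)$ for all $i$ infer $N_k(\mathcal B,\mathcal X,C\alpha)$); probabilistic axioms for $P$: $P_{\geqslant0}\alpha$, $P_{\leqslant r}\alpha\to P_{<t}\alpha$ ($t>r$), $P_{<t}\alpha\to P_{\leqslant t}\alpha$, $(P_{\geqslant r}\alpha\wedge P_{\geqslant t}\beta\wedge P_{\geqslant1}\neg(\alpha\wedge\beta))\to P_{\geqslant\min(1,r+t)}(\alpha\vee\beta)$, $(P_{\leqslant r}\alpha\wedge P_{<t}\alpha)\to P_{<r+t}(\alpha\vee\beta)$ ($r+t\leqslant1$), $P_{\geqslant1}\ominus(\alpha\wedge\neg\alpha)$, necessitation $\alpha/P_{\geqslant1}\alpha$, Archimedean rule (from $N_k(\mathcal B,\mathcal X,P_{\geqslant r-1/i}\alpha)$ for all $i\geqslant1/r$ infer $N_k(\mathcal B,\mathcal X,P_{\geqslant r}\alpha)$, $r\in(0,1]\cap\mathbb Q$); the same for $P_{a,\cdot}$ except the axiom $P_{\geqslant1}\ominus(\alpha\wedge\neg\alpha)$.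 $T\vdash\alpha$ means there is a derivation of at most countable successor-ordinal length whose members are axioms, members of $T$, or obtained by rules from earlier members, where the necessitation rules may only be applied to theorems. -}

module Defs where

open import Data.Nat using (ℕ; zero; suc)
open import Data.Fin using (Fin)
open import Data.List using (List; []; _∷_; _++_; map; upTo; allFin)
open import Data.Bool using (Bool; true; false; not; _∧_)
open import Data.Empty using (⊥)
open import Data.Product using (Σ; _×_; _,_)
open import Relation.Binary.PropositionalEquality using (_≡_; refl; subst)
open import Data.Integer using (+_)
open import Data.Rational as ℚ using (ℚ; 0ℚ; 1ℚ; _≤_; _<_; _+_; _-_; -_; _⊓_)
open import Data.Rational.Properties as ℚP using ()

-- Probability indices: rationals in [0,1] (proofs irrelevant, so two
-- indices with the same value are equal).

record Q01 : Set where
  constructor q01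
  field
    val : ℚ
    .lo : 0ℚ ≤ val
    .hi : val ≤ 1ℚ
open Q01 public

q0 : Q01
q0 = q01 0ℚ (ℚP.≤-refl {0ℚ}) (ℚP.<⇒≤ (ℚP.positive⁻¹ 1ℚ))

q1 : Q01
q1 = q01 1ℚ (ℚP.<⇒≤ (ℚP.positive⁻¹ 1ℚ)) (ℚP.≤-refl {1ℚ})

comp-lo : ∀ s → s ≤ 1ℚ → 0ℚ ≤ 1ℚ - s
comp-lo s hi = subst (_≤ 1ℚ - s) (ℚP.+-inverseʳ s) (ℚP.+-monoˡ-≤ (- s) hi)

comp-hi : ∀ s → 0ℚ ≤ s → 1ℚ - s ≤ 1ℚ
comp-hi s lo = subst (1ℚ - s ≤_) (ℚP.+-identityʳ 1ℚ)
                 (ℚP.+-monoʳ-≤ 1ℚ (ℚP.neg-antimono-≤ lo))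

comp : Q01 → Q01
comp (q01 s lo hi) = q01 (1ℚ - s) (comp-lo s hi) (comp-hi s lo)

module PTEL (n : ℕ) where

  Agent : Set
  Agent = Fin n

  infixr 6 _∧'_
  infix 8 ¬'_
  infix 7 _U_ _S_
  data Form : Set where
    var   : ℕ → Form
    act   : Agent → Form
    ¬'_   : Form → Form
    _∧'_  : Form → Form → Form
    ○     : Form → Form
    ⊖     : Form → Form
    K     : Agent → Form → Form
    C     : Form → Form
    P≥    : Q01 → Form → Form
    Pa≥   : Agent → Q01 → Form → Form
    _U_   : Form → Form → Form
    _S_   : Form → Form → Form

  infixr 4 _⇒_
  infixr 5 _∨'_
  infix 3 _⇔_
  _⇒_ : Form → Form → Form
  α ⇒ β = ¬' (α ∧' ¬' β)

  _∨'_ : Form → Form → Form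
  α ∨' β = ¬' (¬' α ∧' ¬' β)

  _⇔_ : Form → Form → Form
  α ⇔ β = (α ⇒ β) ∧' (β ⇒ α)

  ⊤' : Form
  ⊤' = var 0 ⇒ var 0

  ⋀ : List Form → Form
  ⋀ []           = ⊤'
  ⋀ (x ∷ [])     = x
  ⋀ (x ∷ y ∷ xs) = x ∧' ⋀ (y ∷ xs)

  E : Form → Form
  E α = ⋀ (map (λ a → K a α) (allFin n))

  E^ : ℕ → Form → Form
  E^ zero    α = α
  E^ (suc m) α = E (E^ m α)

  F : Form → Form
  F α = (α ⇒ α) U α

  P< P≤ : Q01 → Form → Form
  P< s α = ¬' (P≥ s α)
  P≤ s α = P≥ (comp s) (¬' α)

  Pa< Pa≤ : Agent → Q01 → Form → Form
  Pa< a s α = ¬' (Pa≥ a s α)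
  Pa≤ a s α = Pa≥ a (comp s) (¬' α)

  iter : (Form → Form) → ℕ → Form → Form
  iter f zero    α = α
  iter f (suc m) α = f (iter f m α)

  data Op : Set where
    opK : Agent → Op
    op○ op⊖ : Op

  applyOp : Op → Form → Form
  applyOp (opK a) = K a
  applyOp op○     = ○
  applyOp op⊖     = ⊖

  -- base β₀  ~  N₀ ; step βₖ Xₖ c  ~  βₖ → Xₖ (N_{k-1} …)
  data Nest : Set where
    base : Form → Nest
    step : Form → Op → Nest → Nest

  N : Nest → Form → Form
  N (base β)       α = β ⇒ α
  N (step β X c)   α = β ⇒ applyOp X (N c α)

  -- propositional tautologies: valid when every non-¬/∧ subformula is an atom
  eval : (Form → Bool) → Form → Bool
  eval v (¬' α)   = not (eval v α)
  eval v (α ∧' β) = eval v α ∧ eval v β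
  eval v φ        = v φ

  Tautology : Form → Set
  Tautology φ = (v : Form → Bool) → eval v φ ≡ true

  untilPrem : Form → Form → ℕ → Form
  untilPrem α β i = ¬' ⋀ (map (λ l → iter ○ l α) (upTo i) ++ (iter ○ i β ∷ []))

  sincePrem : Form → Form → ℕ → Form
  sincePrem α β i = ¬' ⋀ (map (λ l → iter ⊖ l α) (upTo i)
                         ++ map (λ l → ¬' iter ⊖ l (α ∧' ¬' α)) (upTo (suc i))
                         ++ (iter ⊖ i β ∷ []))

  data Axiom : Form → Set where
    taut   : ∀ {φ} → Tautology φ → Axiom φ
    t1  : ∀ α → Axiom (¬' ○ α ⇔ ○ (¬' α))
    t2  : ∀ α β → Axiom (○ (α ⇒ β) ⇒ (○ α ⇒ ○ β))
    t3  : ∀ α β → Axiom ((α U β) ⇔ (β ∨' (α ∧' ○ (α U β))))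
    t4  : ∀ α β → Axiom ((α U β) ⇒ F β)
    t5  : ∀ α → Axiom (¬' ⊖ (¬' α) ⇒ ⊖ α)
    t6  : ∀ α β → Axiom (⊖ (α ⇒ β) ⇒ (⊖ α ⇒ ⊖ β))
    t7  : ∀ α β → Axiom ((⊖ α ∧' ⊖ β) ⇒ ⊖ (α ∧' β))
    t8  : ∀ α → Axiom (○ (⊖ α) ⇔ α)
    t9  : ∀ α → Axiom (○ (⊖ α) ⇒ ⊖ (○ α))
    t10 : ∀ γ α → Axiom (¬' ⊖ (γ ∧' ¬' γ) ⇒ (○ (⊖ α) ⇔ ⊖ (○ α)))
    t11 : ∀ α β → Axiom ((α S β) ⇔ (β ∨' (¬' ⊖ (α ∧' ¬' α) ∧' (α ∧' ⊖ (α S β)))))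
    t12 : ∀ β → Axiom ((⊖ β ⇒ ⊖ β) S ⊖ β)
    e1  : ∀ a α β → Axiom (K a (α ⇒ β) ⇒ (K a α ⇒ K a β))
    e2  : ∀ a α → Axiom (act a ⇒ (K a α ⇒ α))
    e3  : ∀ a → Axiom (act a ⇒ K a (act a))
    e4  : ∀ a α → Axiom (¬' act a ⇒ K a (α ∧' ¬' α))
    e5  : ∀ a α → Axiom (K a (¬' α) ⇒ K a (¬' K a α))
    e6  : ∀ a α → Axiom (K a α ⇒ K a (K a α))
    e7  : ∀ α m → Axiom (C α ⇒ E^ m α)
    p1  : ∀ α → Axiom (P≥ q0 α)
    p2  : ∀ r t α → val r < val t → Axiom (P≤ r α ⇒ P< t α)
    p3  : ∀ t α → Axiom (P< t α ⇒ P≤ t α)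
    p4  : ∀ r t u α β → val u ≡ 1ℚ ⊓ (val r + val t) →
          Axiom ((P≥ r α ∧' (P≥ t β ∧' P≥ q1 (¬' (α ∧' β)))) ⇒ P≥ u (α ∨' β))
    p5  : ∀ r t u α β → val u ≡ val r + val t →
          Axiom ((P≤ r α ∧' P< t β) ⇒ P< u (α ∨' β))
    p6  : ∀ α → Axiom (P≥ q1 (⊖ (α ∧' ¬' α)))
    pa1 : ∀ a α → Axiom (Pa≥ a q0 α)
    pa2 : ∀ a r t α → val r < val t → Axiom (Pa≤ a r α ⇒ Pa< a t α)
    pa3 : ∀ a t α → Axiom (Pa< a t α ⇒ Pa≤ a t α)
    pa4 : ∀ a r t u α β → val u ≡ 1ℚ ⊓ (val r + val t) →
          Axiom ((Pa≥ a r α ∧' (Pa≥ a t β ∧' Pa≥ a q1 (¬' (α ∧' β)))) ⇒ Pa≥ a u (α ∨' β))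
    pa5 : ∀ a r t u α β → val u ≡ val r + val t →
          Axiom ((Pa≤ a r α ∧' Pa< a t β) ⇒ Pa< a u (α ∨' β))

  Theory : Set₁
  Theory = Form → Set

  ∅ : Theory
  ∅ _ = ⊥

  inv : ℕ → ℚ
  inv i = + 1 ℚ./ suc i

  infix 2 _⊢_
  data _⊢_ : Theory → Form → Set₁ where
    ax   : ∀ {T φ} → Axiom φ → T ⊢ φ
    hyp  : ∀ {T φ} → T φ → T ⊢ φ
    mp   : ∀ {T α β} → T ⊢ α → T ⊢ (α ⇒ β) → T ⊢ β
    nec○ : ∀ {T α} → ∅ ⊢ α → T ⊢ ○ α
    nec⊖ : ∀ {T α} → ∅ ⊢ α → T ⊢ ⊖ α
    necK : ∀ {T α} a → ∅ ⊢ α → T ⊢ K a α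
    necP : ∀ {T α} → ∅ ⊢ α → T ⊢ P≥ q1 α
    necPa : ∀ {T α} a → ∅ ⊢ α → T ⊢ Pa≥ a q1 α
    RU   : ∀ {T} c α β → (∀ i → T ⊢ N c (untilPrem α β i)) → T ⊢ N c (¬' (α U β))
    RS   : ∀ {T} c α β → (∀ i → T ⊢ N c (sincePrem α β i)) → T ⊢ N c (¬' (α S β))
    RC   : ∀ {T} c α → (∀ i → T ⊢ N c (E^ i α)) → T ⊢ N c (C α)
    -- Archimedean rules, r ∈ (0,1]; the premises range over all i ≥ 1 with
    -- r - 1/i ≥ 0 (i.e. i ≥ 1/r), the index u being r - 1/i
    RA   : ∀ {T} c r α → 0ℚ < val r →
           (∀ i (u : Q01) → val u ≡ val r - inv i → T ⊢ N c (P≥ u α)) →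
           T ⊢ N c (P≥ r α)
    RAa  : ∀ {T} c a r α → 0ℚ < val r →
           (∀ i (u : Q01) → val u ≡ val r - inv i → T ⊢ N c (Pa≥ a u α)) →
           T ⊢ N c (Pa≥ a r α)

  ○T ⊖T : Theory → Theory
  ○T T φ = Σ Form λ α → T α × (φ ≡ ○ α)
  ⊖T T φ = Σ Form λ α → T α × (φ ≡ ⊖ α)

  KT : Agent → Theory → Theory
  KT a T φ = Σ Form λ α → T α × (φ ≡ K a α)

-- A hypothesis
-- α becomes the hypothesis X α, modus ponens is transported by the distribution
-- axiom for X, and the conclusion of a necessitation rule is a theorem, so X of
-- it follows by necessitation again. The infinitary rules are why they are
-- stated for k-nested implications: the conclusion N_k(B, X⃗, φ) of a rule,
-- prefixed by X and by the tautological antecedent ⊤, is N_{k+1}(B ⊤, X⃗ X, φ),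
-- the conclusion of the same rule one nesting level deeper.
module Submission where

open import Defs
open import Data.Nat using (ℕ)
open import Data.Product using (_×_; _,_; Σ)
open import Data.Bool using (true; false)
open import Relation.Binary.PropositionalEquality using (_≡_; refl)

module StrongNecessitation (n : ℕ) where
  open PTEL n

  image : Op → Theory → Theory
  image X T φ = Σ Form λ α → T α × (φ ≡ applyOp X α)

  applyOp-distrib : ∀ X α β → Axiom (applyOp X (α ⇒ β) ⇒ (applyOp X α ⇒ applyOp X β))
  applyOp-distrib (opK a) = e1 a
  applyOp-distrib op○     = t2
  applyOp-distrib op⊖     = t6

  applyOp-nec : ∀ {T α} X → ∅ ⊢ α → T ⊢ applyOp X α
  applyOp-nec (opK a) = necK a
  applyOp-nec op○     = nec○
  applyOp-nec op⊖     = nec⊖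

  ⊤'-tautology : Tautology ⊤'
  ⊤'-tautology v with v (var 0)
  ... | true  = refl
  ... | false = refl

  ⇒-⊤'⇒-tautology : ∀ φ → Tautology (φ ⇒ (⊤' ⇒ φ))
  ⇒-⊤'⇒-tautology φ v with eval v φ | v (var 0)
  ... | true  | true  = refl
  ... | true  | false = refl
  ... | false | true  = refl
  ... | false | false = refl

  ⊤'⇒-intro : ∀ {T φ} → T ⊢ φ → T ⊢ (⊤' ⇒ φ)
  ⊤'⇒-intro {φ = φ} d = mp d (ax (taut (⇒-⊤'⇒-tautology φ)))

  ⊤'⇒-elim : ∀ {T φ} → T ⊢ (⊤' ⇒ φ) → T ⊢ φ
  ⊤'⇒-elim = mp (ax (taut ⊤'-tautology))

  strong-nec : ∀ X {T γ} → T ⊢ γ → image X T ⊢ applyOp X γ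
  strong-nec X (ax a)       = applyOp-nec X (ax a)
  strong-nec X (hyp t)      = hyp (_ , t , refl)
  strong-nec X (mp d e)     = mp (strong-nec X d) (mp (strong-nec X e) (ax (applyOp-distrib X _ _)))
  strong-nec X (nec○ d)     = applyOp-nec X (nec○ d)
  strong-nec X (nec⊖ d)     = applyOp-nec X (nec⊖ d)
  strong-nec X (necK a d)   = applyOp-nec X (necK a d)
  strong-nec X (necP d)     = applyOp-nec X (necP d)
  strong-nec X (necPa a d)  = applyOp-nec X (necPa a d)
  strong-nec X (RU c α β ps) =
    ⊤'⇒-elim (RU (step ⊤' X c) α β λ i → ⊤'⇒-intro (strong-nec X (ps i)))
  strong-nec X (RS c α β ps) =
    ⊤'⇒-elim (RS (step ⊤' X c) α β λ i → ⊤'⇒-intro (strong-nec X (ps i)))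
  strong-nec X (RC c α ps) =
    ⊤'⇒-elim (RC (step ⊤' X c) α λ i → ⊤'⇒-intro (strong-nec X (ps i)))
  strong-nec X (RA c r α r>0 ps) =
    ⊤'⇒-elim (RA (step ⊤' X c) r α r>0 λ i u u≡ → ⊤'⇒-intro (strong-nec X (ps i u u≡)))
  strong-nec X (RAa c a r α r>0 ps) =
    ⊤'⇒-elim (RAa (step ⊤' X c) a r α r>0 λ i u u≡ → ⊤'⇒-intro (strong-nec X (ps i u u≡)))

theorem2 : (n : ℕ) → let open PTEL n in
    (T : Theory) (γ : Form) → T ⊢ γ →
    (○T T ⊢ ○ γ) × (⊖T T ⊢ ⊖ γ) × ((a : Agent) → KT a T ⊢ K a γ)
theorem2 n T γ d = strong-nec op○ d , strong-nec op⊖ d , λ a → strong-nec (opK a) d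
  where open PTEL n
        open StrongNecessitation n
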